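{- Let $\mathcal{R}=\mathcal{R}_1\cup\mathcal{R}_2$ be a TRS over $\mathcal{F}$. There exists a strongly linear interpretation $\mathcal{M}$ compatible with $\mathcal{R}$ if and only if there exist strongly linear interpretations $\mathcal{M}_1,\mathcal{M}_2$ such that $\mathcal{M}_1$ is compatible with $\mathcal{R}_1/\mathcal{R}_2$ and $\mathcal{M}_2$ is compatible with $\mathcal{R}_2/\mathcal{R}_1$.
   Context: A strongly linear interpretation (SLI) $\mathcal{M}$ interprets each $n$-ary $f\in\mathcal{F}$ over $\mathbb{N}$ as $f_{\mathcal{M}}(x_1,\dots,x_n)=x_1+\dots+x_n+c_f$ with $c_f\in\mathbb{N}$. $s>_{\mathcal{M}}t$ ($s\ge_{\mathcal{M}}t$) iff $[\alpha]_{\mathcal{M}}(s)>[\alpha]_{\mathcal{M}}(t)$ ($\ge$) for all assignments $\alpha$ into $\mathbb{N}$. $\mathcal{M}$ is compatible with a TRS $\mathcal{R}$ if $l>_{\mathcal{M}}r$ for all rules of $\mathcal{R}$, and with a relative TRS $\mathcal{A}/\mathcal{B}$ if $l>_{\mathcal{M}}r$ for all $l\to r\in\mathcal{A}$ and $l\ge_{\mathcal{M}}r$ for all $l\to r\in\mathcal{B}$. -}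

module Defs where

open import Data.Nat using (ℕ; _+_; _<_; _≤_)
open import Data.Vec using (Vec; []; _∷_)
open import Data.Product using (_×_; proj₁; proj₂)
open import Level using (Level; suc; _⊔_)

record Signature : Set₁ where
  field
    Sym   : Set
    arity : Sym → ℕ
open Signature public

Var : Set
Var = ℕ

module _ (Σ : Signature) where

  data Term : Set where
    var : Var → Term
    fun : (f : Sym Σ) → Vec Term (arity Σ f) → Term

  Rule : Set
  Rule = Term × Term

  TRS : Set₁
  TRS = Rule → Set

  _∪_ : TRS → TRS → TRS
  (R₁ ∪ R₂) ρ = Data.Sum._⊎_ (R₁ ρ) (R₂ ρ)
    where import Data.Sum

  -- A strongly linear interpretation is determined by the constants c_f:
  -- f_M(x₁,…,xₙ) = x₁ + … + xₙ + c_f.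
  SLI : Set
  SLI = Sym Σ → ℕ

  mutual
    ⟦_⟧ : Term → SLI → (Var → ℕ) → ℕ
    ⟦ var x ⟧ M α = α x
    ⟦ fun f ts ⟧ M α = ⟦ ts ⟧* M α + M f

    ⟦_⟧* : ∀ {n} → Vec Term n → SLI → (Var → ℕ) → ℕ
    ⟦ [] ⟧* M α = 0
    ⟦ t ∷ ts ⟧* M α = ⟦ t ⟧ M α + ⟦ ts ⟧* M α

  _>[_]_ : Term → SLI → Term → Set
  s >[ M ] t = ∀ (α : Var → ℕ) → ⟦ t ⟧ M α < ⟦ s ⟧ M α

  _≥[_]_ : Term → SLI → Term → Set
  s ≥[ M ] t = ∀ (α : Var → ℕ) → ⟦ t ⟧ M α ≤ ⟦ s ⟧ M α

  Compatible : SLI → TRS → Set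
  Compatible M R = ∀ ρ → R ρ → proj₁ ρ >[ M ] proj₂ ρ

  CompatibleRel : SLI → TRS → TRS → Set
  CompatibleRel M A B =
    (∀ ρ → A ρ → proj₁ ρ >[ M ] proj₂ ρ) × (∀ ρ → B ρ → proj₁ ρ ≥[ M ] proj₂ ρ)

module Submission where

-- Strongly linear interpretations can be added by adding
-- their constants pointwise, and evaluation is additive:
-- under M₁ ⊕ M₂ a term evaluates, at an assignment splitting pointwise as
-- α + β, to its M₁-value at α plus its M₂-value at β.
--
-- (⇒) An interpretation compatible with R₁ ∪ R₂ orients every rule strictly,
--     hence also weakly, so it is compatible with both R₁/R₂ and R₂/R₁.
-- (⇐) Given M₁ for R₁/R₂ and M₂ for R₂/R₁, the sum M₁ ⊕ M₂ orients every
--     rule of R₁ ∪ R₂ strictly: split the assignment α as α + 0 (or 0 + α);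
--     one summand decreases strictly and the other weakly.

open import Defs
open import Data.Product using (_×_; ∃; _,_)
open import Function.Bundles using (_⇔_; mk⇔)
open import Data.Nat using (ℕ; _+_; _<_)
open import Data.Nat.Properties
  using (+-identityʳ; +-mono-<-≤; +-mono-≤-<; <⇒≤; +-commutativeSemigroup)
open import Algebra.Properties.CommutativeSemigroup +-commutativeSemigroup
  using (interchange)
open import Data.Vec using (Vec; []; _∷_)
open import Data.Sum using (inj₁; inj₂)
open import Relation.Binary.PropositionalEquality
  using (_≡_; refl; sym; trans; cong₂; subst₂)

module SumOfInterpretations (Σ : Signature) where

  _⊕_ : SLI Σ → SLI Σ → SLI Σ
  (M₁ ⊕ M₂) f = M₁ f + M₂ f

  module _ (M₁ M₂ : SLI Σ) (α β γ : Var → ℕ)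
           (γ-split : ∀ x → γ x ≡ α x + β x) where
    mutual
      eval-⊕ : (t : Term Σ) →
               ⟦_⟧ Σ t (M₁ ⊕ M₂) γ ≡ ⟦_⟧ Σ t M₁ α + ⟦_⟧ Σ t M₂ β
      eval-⊕ (var x) = γ-split x
      eval-⊕ (fun f ts) = trans (cong₂ _+_ (eval-⊕* ts) refl)
        (interchange (⟦_⟧* Σ ts M₁ α) (⟦_⟧* Σ ts M₂ β) (M₁ f) (M₂ f))

      eval-⊕* : ∀ {n} (ts : Vec (Term Σ) n) →
                ⟦_⟧* Σ ts (M₁ ⊕ M₂) γ ≡ ⟦_⟧* Σ ts M₁ α + ⟦_⟧* Σ ts M₂ β
      eval-⊕* [] = refl
      eval-⊕* (t ∷ ts) = trans (cong₂ _+_ (eval-⊕ t) (eval-⊕* ts))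
        (interchange (⟦_⟧ Σ t M₁ α) (⟦_⟧ Σ t M₂ β) (⟦_⟧* Σ ts M₁ α) (⟦_⟧* Σ ts M₂ β))

  zeroₐ : Var → ℕ
  zeroₐ _ = 0

  -- A rule oriented strictly by M₁ and weakly by M₂ is oriented strictly by
  -- M₁ ⊕ M₂: evaluate at α = α + 0, using α for M₁ and 0 for M₂.
  strict-⊕-weak : ∀ {M₁ M₂ : SLI Σ} {l r : Term Σ} →
                  _>[_]_ Σ l M₁ r → _≥[_]_ Σ l M₂ r → _>[_]_ Σ l (M₁ ⊕ M₂) r
  strict-⊕-weak {M₁} {M₂} {l} {r} l>r l≥r α =
    subst₂ _<_ (sym (eval-⊕ M₁ M₂ α zeroₐ α α+0 r)) (sym (eval-⊕ M₁ M₂ α zeroₐ α α+0 l))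
      (+-mono-<-≤ (l>r α) (l≥r zeroₐ))
    where
    α+0 : ∀ x → α x ≡ α x + 0
    α+0 x = sym (+-identityʳ (α x))

  weak-⊕-strict : ∀ {M₁ M₂ : SLI Σ} {l r : Term Σ} →
                  _≥[_]_ Σ l M₁ r → _>[_]_ Σ l M₂ r → _>[_]_ Σ l (M₁ ⊕ M₂) r
  weak-⊕-strict {M₁} {M₂} {l} {r} l≥r l>r α =
    subst₂ _<_ (sym (eval-⊕ M₁ M₂ zeroₐ α α 0+α r)) (sym (eval-⊕ M₁ M₂ zeroₐ α α 0+α l))
      (+-mono-≤-< (l≥r zeroₐ) (l>r α))
    where
    0+α : ∀ x → α x ≡ 0 + α x
    0+α x = refl

  compatible⇒compatibleRel : ∀ {M : SLI Σ} {A B : TRS Σ} →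
    Compatible Σ M (_∪_ Σ A B) → CompatibleRel Σ M A B
  compatible⇒compatibleRel M-compat =
    (λ ρ ρ∈A → M-compat ρ (inj₁ ρ∈A)) , (λ ρ ρ∈B α → <⇒≤ (M-compat ρ (inj₂ ρ∈B) α))

  compatible-∪-swap : ∀ {M : SLI Σ} {A B : TRS Σ} →
    Compatible Σ M (_∪_ Σ A B) → Compatible Σ M (_∪_ Σ B A)
  compatible-∪-swap M-compat ρ (inj₁ ρ∈B) = M-compat ρ (inj₂ ρ∈B)
  compatible-∪-swap M-compat ρ (inj₂ ρ∈A) = M-compat ρ (inj₁ ρ∈A)

  compatibleRel-⊕ : ∀ {M₁ M₂ : SLI Σ} {A B : TRS Σ} →
    CompatibleRel Σ M₁ A B → CompatibleRel Σ M₂ B A → Compatible Σ (M₁ ⊕ M₂) (_∪_ Σ A B)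
  compatibleRel-⊕ (A>₁ , B≥₁) (B>₂ , A≥₂) (l , r) (inj₁ ρ∈A) =
    strict-⊕-weak {l = l} {r} (A>₁ (l , r) ρ∈A) (A≥₂ (l , r) ρ∈A)
  compatibleRel-⊕ (A>₁ , B≥₁) (B>₂ , A≥₂) (l , r) (inj₂ ρ∈B) =
    weak-⊕-strict {l = l} {r} (B≥₁ (l , r) ρ∈B) (B>₂ (l , r) ρ∈B)

lemma6p1 : (Σ : Signature) (R₁ R₂ : TRS Σ) →
    (∃ λ (M : SLI Σ) → Compatible Σ M (_∪_ Σ R₁ R₂)) ⇔
    ((∃ λ (M₁ : SLI Σ) → CompatibleRel Σ M₁ R₁ R₂) × (∃ λ (M₂ : SLI Σ) → CompatibleRel Σ M₂ R₂ R₁))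
lemma6p1 Σ R₁ R₂ = mk⇔ split combine
  where
  open SumOfInterpretations Σ

  split : ∃ (λ M → Compatible Σ M (_∪_ Σ R₁ R₂)) →
          ∃ (λ M₁ → CompatibleRel Σ M₁ R₁ R₂) × ∃ (λ M₂ → CompatibleRel Σ M₂ R₂ R₁)
  split (M , M-compat) =
    (M , compatible⇒compatibleRel M-compat) ,
    (M , compatible⇒compatibleRel (compatible-∪-swap M-compat))

  combine : ∃ (λ M₁ → CompatibleRel Σ M₁ R₁ R₂) × ∃ (λ M₂ → CompatibleRel Σ M₂ R₂ R₁) →
            ∃ (λ M → Compatible Σ M (_∪_ Σ R₁ R₂))
  combine ((M₁ , M₁-compat) , (M₂ , M₂-compat)) =
    M₁ ⊕ M₂ , compatibleRel-⊕ M₁-compat M₂-compat
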